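{- The linear map $\iota:\mathrm{NCSym}_2\to\mathrm{NSym}$ defined by $\iota(\mathbf{m}_A[X_2])=\mathbf{R}_{c(A)}$ for every set partition $A$ with $\ell(A)\le2$ (and $\iota(1)=1$) is an isomorphism of algebras.
   Context: $X_2=\{x_1,x_2\}$ noncommuting variables, $\mathbb{Q}\langle X_2\rangle$ the free associative algebra. For $A\vdash[m]$ (a set partition of $[m]$ into nonempty blocks, $\ell(A)$ blocks) let $\mathbf{m}_A[X_2]=\sum x_{i_1}\cdots x_{i_m}$ over all sequences $(i_1,\dots,i_m)\in\{1,2\}^m$ such that $i_a=i_b$ iff $a,b$ lie in the same block of $A$. $\mathrm{NCSym}_2$ is the subalgebra of $\mathbb{Q}\langle X_2\rangle$ of polynomials invariant under swapping $x_1,x_2$; it has basis $\{\mathbf{m}_A[X_2]:\ell(A)\le2\}$. For $A\vdash[n]$ with $\ell(A)\le2$, $c(A)$ is the composition of $n$ obtained as follows: read $1,\dots,n$ and cut between $i$ and $i+1$ exactly when $i$ and $i+1$ lie in different blocks; $c(A)$ lists the lengths of the resulting maximal runs (e.g. $c(\{1245,3678\})=(2,1,2,3)$). $\mathrm{NSym}=\mathbb{Q}\langle\mathbf{h}_1,\mathbf{h}_2,\dots\rangle$ is the free associative algebra, $\mathbf{h}_\alpha=\mathbf{h}_{\alpha_1}\cdots\mathbf{h}_{\alpha_k}$, and the ribbon Schur functions are $\mathbf{R}_\alpha=\sum_{\beta}(-1)^{\ell(\alpha)-\ell(\beta)}\mathbf{h}_\beta$, the sum over all compositions $\beta$ that are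 coarsenings of $\alpha$ (i.e. $D(\beta)\subseteq D(\alpha)$, where $D$ is the set of partial sums). -}

module Defs where

open import Data.Bool using (Bool; true; false; if_then_else_; _∧_; not)
open import Data.Bool.Properties using () renaming (_≟_ to _≟B_)
open import Data.Nat using (ℕ; zero; suc; _+_; _∸_; _≤_)
import Data.Nat as ℕ
open import Data.List using (List; []; _∷_; _++_; map; concatMap; length; filter; foldr)
open import Data.List.Properties using (≡-dec)
open import Data.List.Relation.Unary.All using (All)
open import Data.Product using (Σ; _×_; _,_; proj₁; proj₂; ∃)
open import Data.Unit using (⊤)
open import Data.Rational using (ℚ; 0ℚ; 1ℚ; -_) renaming (_+_ to _+ℚ_; _*_ to _*ℚ_)
open import Relation.Binary.PropositionalEquality using (_≡_)
open import Relation.Nullary.Decidable using (does)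

-- Q<X_2>: noncommutative polynomials in x₁ = false, x₂ = true over ℚ,
-- as finite formal sums of words; equality = equal coefficients.

Word : Set
Word = List Bool

Poly : Set
Poly = List (ℚ × Word)

coeffP : Poly → Word → ℚ
coeffP [] w = 0ℚ
coeffP ((q , u) ∷ p) w = (if does (≡-dec _≟B_ u w) then q else 0ℚ) +ℚ coeffP p w

infix 4 _≈P_
_≈P_ : Poly → Poly → Set
p ≈P p' = ∀ w → coeffP p w ≡ coeffP p' w

infixl 7 _*P_
_*P_ : Poly → Poly → Poly
p *P p' = concatMap (λ t → map (λ t' → (proj₁ t *ℚ proj₁ t') , (proj₂ t ++ proj₂ t')) p') p

scaleP : ℚ → Poly → Poly
scaleP q = map (λ t → (q *ℚ proj₁ t) , proj₂ t)

-- NSym = ℚ⟨h₁,h₂,…⟩ in the basis h_α (α a composition, list of positive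
-- naturals); finite formal sums, equality = equal coefficients.

Comp : Set
Comp = List ℕ

NSym : Set
NSym = List (ℚ × Comp)

ValidNSym : NSym → Set
ValidNSym y = All (λ t → All (λ a → 1 ≤ a) (proj₂ t)) y

coeffN : NSym → Comp → ℚ
coeffN [] α = 0ℚ
coeffN ((q , β) ∷ y) α = (if does (≡-dec ℕ._≟_ β α) then q else 0ℚ) +ℚ coeffN y α

infix 4 _≈N_
_≈N_ : NSym → NSym → Set
y ≈N y' = ∀ α → coeffN y α ≡ coeffN y' α

infixl 7 _*N_
_*N_ : NSym → NSym → NSym
y *N y' = concatMap (λ t → map (λ t' → (proj₁ t *ℚ proj₁ t') , (proj₂ t ++ proj₂ t')) y') y

scaleN : ℚ → NSym → NSym
scaleN q = map (λ t → (q *ℚ proj₁ t) , proj₂ t)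

oneN : NSym
oneN = (1ℚ , []) ∷ []

sgn : ℕ → ℚ
sgn zero = 1ℚ
sgn (suc k) = - sgn k

-- all coarsenings of a composition (merging adjacent parts), each once
-- coarsFrom a r = coarsenings of (a ∷ r)
coarsFrom : ℕ → Comp → List Comp
coarsFrom a [] = (a ∷ []) ∷ []
coarsFrom a (b ∷ r) = map (a ∷_) (coarsFrom b r) ++ coarsFrom (a + b) r

coarsenings : Comp → List Comp
coarsenings [] = [] ∷ []
coarsenings (a ∷ r) = coarsFrom a r

ribbon : Comp → NSym
ribbon α = map (λ β → sgn (length α ∸ length β) , β) (coarsenings α)

-- Set partitions of [m] with ≤ 2 blocks, encoded by a block labelling
-- w ∈ {false,true}^m (i, j in the same block iff w_i ≡ w_j), normalised
-- so that element 1 has label false (restricted growth word).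

Canonical : Word → Set
Canonical [] = ⊤
Canonical (b ∷ _) = b ≡ false

SetPart2 : Set
SetPart2 = Σ Word Canonical

eqB : Bool → Bool → Bool
eqB b c = does (b ≟B c)

allB : {A : Set} → (A → Bool) → List A → Bool
allB P = foldr (λ x r → P x ∧ r) true

allWords : ℕ → List Word
allWords zero = [] ∷ []
allWords (suc m) = concatMap (λ w → (false ∷ w) ∷ (true ∷ w) ∷ []) (allWords m)

zipL : Word → Word → List (Bool × Bool)
zipL [] _ = []
zipL (_ ∷ _) [] = []
zipL (a ∷ u) (b ∷ v) = (a , b) ∷ zipL u v

-- sequence i (first) has the block pattern of labelling A (second):
-- for all positions a, b:  i_a = i_b  iff  A_a = A_b
samePattern : Word → Word → Bool
samePattern i A =
  allB (λ p → allB (λ q → eqB (eqB (proj₁ p) (proj₁ q)) (eqB (proj₂ p) (proj₂ q))) (zipL i A)) (zipL i A)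

mono : SetPart2 → Poly
mono (A , _) = map (λ w → 1ℚ , w) (filter (λ w → samePattern w A Data.Bool.≟ true) (allWords (length A)))
  where import Data.Bool

-- c(A): lengths of maximal runs of consecutive elements in one block
runsFrom : Bool → ℕ → Word → Comp
runsFrom b k [] = k ∷ []
runsFrom b k (b' ∷ w) = if eqB b b' then runsFrom b (suc k) w else k ∷ runsFrom b' 1 w

cmp : SetPart2 → Comp
cmp ([] , _) = []
cmp ((b ∷ w) , _) = runsFrom b 1 w

-- NCSym₂ = span of the m_A[X_2]; an element is presented by a finite
-- formal combination of basis symbols, realised in ℚ⟨X₂⟩ by `emb`.

NCComb : Set
NCComb = List (ℚ × SetPart2)

emb : NCComb → Poly
emb = concatMap (λ t → scaleP (proj₁ t) (mono (proj₂ t)))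

ι : NCComb → NSym
ι = concatMap (λ t → scaleN (proj₁ t) (ribbon (cmp (proj₂ t))))

oneNC : NCComb
oneNC = (1ℚ , ([] , _)) ∷ []

{-# OPTIONS --safe #-}
-- A set partition A with ℓ(A) ≤ 2 is a word in x₁, x₂ up to swapping the two letters, and
-- m_A = w + w̄ is the sum of its two representatives.  Words starting with x₁ correspond to
-- compositions through their runs, so ι extends to the linear map on ℚ⟨X₂⟩ sending w to R_{c(w)}
-- if w starts with x₁ and to 0 otherwise; hence ι depends only on the polynomial.  The inverse of
-- ι sends h_β to the sum of the m_A with c(A) a coarsening of β: both composites are the identity
-- by Möbius inversion on coarsenings, R_γ = Σ_{β coarsening γ} (−1)^{ℓ(γ)−ℓ(β)} h_β.  Finally
-- m_A m_B = m_{AB} + m_{AB̄}, and the run compositions of AB and AB̄ are c(A)·c(B) and c(A)⊙c(B)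
-- in some order, matching R_α R_β = R_{α·β} + R_{α⊙β}.  Elements of the free modules are
-- compared throughout by their values under linear functionals, which depend only on coefficients.
module Submission where

open import Defs
open import Algebra.Bundles using (CommutativeMonoid)
open import Data.Bool using (Bool; true; false; if_then_else_; not; _∧_; _≟_)
open import Data.Bool.Properties using (not-involutive) renaming (_≟_ to _≟B_)
open import Data.Empty using (⊥-elim)
open import Data.List using (List; []; _∷_; _++_; map; concatMap; length; filter; replicate)
open import Data.List.Properties
  using (≡-dec; length-filter; length-map; map-id; map-cong; map-∘; map-++; ++-identityʳ)
open import Data.List.Relation.Unary.All as All using (All; []; _∷_)
open import Data.List.Relation.Unary.All.Properties using (++⁺; map⁺; concat⁺)
open import Data.Nat using (ℕ; zero; suc; _∸_; _≤_; z≤n; s≤s) renaming (_+_ to _+ℕ_)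
import Data.Nat.Properties as ℕ
open import Data.Product using (_×_; ∃; ∃₂; _,_; proj₁; proj₂)
open import Data.Rational using (ℚ; 0ℚ; 1ℚ; -_; _+_; _*_; _-_)
import Data.Rational.Properties as ℚ
open import Data.Rational.Solver using (module +-*-Solver)
open import Data.Sum using (_⊎_; inj₁; inj₂)
open import Data.Unit using (tt)
open import Function using (_∘_)
open import Relation.Binary.Definitions using (DecidableEquality)
open import Relation.Binary.PropositionalEquality
open import Relation.Nullary.Decidable using (does; yes; no; ¬?; dec-true; dec-false)
open import Relation.Unary using (Decidable)

open import Algebra.Properties.CommutativeSemigroup (CommutativeMonoid.commutativeSemigroup ℚ.+-0-commutativeMonoid)
  using () renaming (interchange to +-interchange)
open +-*-Solver using (solve; _:+_; _:*_; :-_; _:=_; con)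
open ≡-Reasoning

-- Sums and formal linear combinations over ℚ

p+q-q≡p : ∀ p q → p + q - q ≡ p
p+q-q≡p = solve 2 (λ p q → p :+ q :+ :- q := p) refl

p-q+q≡p : ∀ p q → p - q + q ≡ p
p-q+q≡p = solve 2 (λ p q → p :+ :- q :+ q := p) refl

[p+q]-[r+s]≡[p-r]+[q-s] : ∀ p q r s → (p + q) - (r + s) ≡ (p - r) + (q - s)
[p+q]-[r+s]≡[p-r]+[q-s] = solve 4 (λ p q r s → (p :+ q) :+ :- (r :+ s) := (p :+ :- r) :+ (q :+ :- s)) refl

[p+q]+[r+s]≡[p+s]+[q+r] : ∀ p q r s → (p + q) + (r + s) ≡ (p + s) + (q + r)
[p+q]+[r+s]≡[p+s]+[q+r] = solve 4 (λ p q r s → (p :+ q) :+ (r :+ s) := (p :+ s) :+ (q :+ r)) refl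

∑ : {A : Set} → List A → (A → ℚ) → ℚ
∑ []       F = 0ℚ
∑ (x ∷ xs) F = F x + ∑ xs F

syntax ∑ xs (λ x → e) = ∑[ x ← xs ] e

module _ {A : Set} where

  ∑-++ : (F : A → ℚ) (xs ys : List A) → ∑ (xs ++ ys) F ≡ ∑ xs F + ∑ ys F
  ∑-++ F []       ys = sym (ℚ.+-identityˡ _)
  ∑-++ F (x ∷ xs) ys = trans (cong (F x +_) (∑-++ F xs ys)) (sym (ℚ.+-assoc (F x) _ _))

  ∑-congAll : {F G : A → ℚ} (xs : List A) → All (λ x → F x ≡ G x) xs → ∑ xs F ≡ ∑ xs G
  ∑-congAll []       []         = refl
  ∑-congAll (x ∷ xs) (e ∷ es) = cong₂ _+_ e (∑-congAll xs es)

  ∑-cong : {F G : A → ℚ} → (∀ x → F x ≡ G x) → (xs : List A) → ∑ xs F ≡ ∑ xs G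
  ∑-cong e []       = refl
  ∑-cong e (x ∷ xs) = cong₂ _+_ (e x) (∑-cong e xs)

  ∑-+ : (F G : A → ℚ) (xs : List A) → ∑[ x ← xs ] (F x + G x) ≡ ∑ xs F + ∑ xs G
  ∑-+ F G []       = refl
  ∑-+ F G (x ∷ xs) = trans (cong (F x + G x +_) (∑-+ F G xs)) (+-interchange (F x) (G x) _ _)

  ∑-neg : (F : A → ℚ) (xs : List A) → ∑[ x ← xs ] (- F x) ≡ - ∑ xs F
  ∑-neg F []       = refl
  ∑-neg F (x ∷ xs) = trans (cong (- F x +_) (∑-neg F xs)) (sym (ℚ.neg-distrib-+ (F x) _))

  ∑-*ˡ : (c : ℚ) (F : A → ℚ) (xs : List A) → ∑[ x ← xs ] (c * F x) ≡ c * ∑ xs F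
  ∑-*ˡ c F []       = sym (ℚ.*-zeroʳ c)
  ∑-*ˡ c F (x ∷ xs) = trans (cong (c * F x +_) (∑-*ˡ c F xs)) (sym (ℚ.*-distribˡ-+ c (F x) _))

  ∑-sub : (F G : A → ℚ) (xs : List A) → ∑[ x ← xs ] (F x - G x) ≡ ∑ xs F - ∑ xs G
  ∑-sub F G xs = trans (∑-+ F (λ x → - G x) xs) (cong (∑ xs F +_) (∑-neg G xs))

  ∑-zero : (xs : List A) → ∑[ x ← xs ] 0ℚ ≡ 0ℚ
  ∑-zero []       = refl
  ∑-zero (x ∷ xs) = trans (ℚ.+-identityˡ _) (∑-zero xs)

∑-map : {A B : Set} (F : B → ℚ) (g : A → B) (xs : List A) → ∑ (map g xs) F ≡ ∑ xs (F ∘ g)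
∑-map F g []       = refl
∑-map F g (x ∷ xs) = cong (F (g x) +_) (∑-map F g xs)

∑-concatMap : {A B : Set} (F : B → ℚ) (g : A → List B) (xs : List A) →
              ∑ (concatMap g xs) F ≡ ∑[ x ← xs ] ∑ (g x) F
∑-concatMap F g []       = refl
∑-concatMap F g (x ∷ xs) = trans (∑-++ F (g x) _) (cong (∑ (g x) F +_) (∑-concatMap F g xs))

∑-swap : {A B : Set} (K : A → B → ℚ) (xs : List A) (ys : List B) →
         ∑[ x ← xs ] ∑[ y ← ys ] K x y ≡ ∑[ y ← ys ] ∑[ x ← xs ] K x y
∑-swap K []       ys = sym (∑-zero ys)
∑-swap K (x ∷ xs) ys = trans (cong (∑ ys (K x) +_) (∑-swap K xs ys)) (sym (∑-+ (K x) _ ys))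

FormalSum : Set → Set
FormalSum X = List (ℚ × X)

module _ {X : Set} where

  eval : (X → ℚ) → FormalSum X → ℚ
  eval H p = ∑[ t ← p ] (proj₁ t * H (proj₂ t))

  scale : ℚ → FormalSum X → FormalSum X
  scale c = map (λ t → c * proj₁ t , proj₂ t)

  eval-cong : {H G : X → ℚ} → (∀ x → H x ≡ G x) → (p : FormalSum X) → eval H p ≡ eval G p
  eval-cong e = ∑-cong (λ t → cong (proj₁ t *_) (e (proj₂ t)))

  eval-congAll : {H G : X → ℚ} (p : FormalSum X) → All (λ t → H (proj₂ t) ≡ G (proj₂ t)) p →
                 eval H p ≡ eval G p
  eval-congAll []       []         = refl
  eval-congAll (t ∷ p) (e ∷ es) = cong₂ (λ a b → proj₁ t * a + b) e (eval-congAll p es)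

  eval-+ : (H G : X → ℚ) (p : FormalSum X) → eval (λ x → H x + G x) p ≡ eval H p + eval G p
  eval-+ H G p = trans (∑-cong (λ t → ℚ.*-distribˡ-+ (proj₁ t) _ _) p) (∑-+ _ _ p)

  eval-scale : (H : X → ℚ) (c : ℚ) (p : FormalSum X) → eval H (scale c p) ≡ c * eval H p
  eval-scale H c p = begin
    eval H (scale c p)                 ≡⟨ ∑-map _ _ p ⟩
    ∑[ t ← p ] (c * proj₁ t * H (proj₂ t)) ≡⟨ ∑-cong (λ t → ℚ.*-assoc c _ _) p ⟩
    ∑[ t ← p ] (c * (proj₁ t * H (proj₂ t))) ≡⟨ ∑-*ˡ c _ p ⟩
    c * eval H p                       ∎

bind : {X Y : Set} → (X → FormalSum Y) → FormalSum X → FormalSum Y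
bind L = concatMap (λ t → scale (proj₁ t) (L (proj₂ t)))

eval-bind : {X Y : Set} (H : Y → ℚ) (L : X → FormalSum Y) (p : FormalSum X) →
            eval H (bind L p) ≡ eval (λ x → eval H (L x)) p
eval-bind H L p = trans (∑-concatMap _ _ p) (∑-cong (λ t → eval-scale H (proj₁ t) (L (proj₂ t))) p)

eval-swap : {X Y : Set} (K : X → Y → ℚ) (p : FormalSum X) (p' : FormalSum Y) →
            eval (λ x → eval (K x) p') p ≡ eval (λ y → eval (λ x → K x y) p) p'
eval-swap K p p' = begin
  ∑[ s ← p ] (proj₁ s * ∑[ t ← p' ] (proj₁ t * K (proj₂ s) (proj₂ t)))
    ≡⟨ ∑-cong (λ s → sym (∑-*ˡ (proj₁ s) _ p')) p ⟩
  ∑[ s ← p ] ∑[ t ← p' ] (proj₁ s * (proj₁ t * K (proj₂ s) (proj₂ t)))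
    ≡⟨ ∑-swap _ p p' ⟩
  ∑[ t ← p' ] ∑[ s ← p ] (proj₁ s * (proj₁ t * K (proj₂ s) (proj₂ t)))
    ≡⟨ ∑-cong (λ t → trans (∑-cong (λ s → solve 3 (λ a b k → a :* (b :* k) := b :* (a :* k)) refl
                                              (proj₁ s) (proj₁ t) _) p)
                           (∑-*ˡ (proj₁ t) _ p)) p' ⟩
  ∑[ t ← p' ] (proj₁ t * ∑[ s ← p ] (proj₁ s * K (proj₂ s) (proj₂ t))) ∎

infixl 7 _⊛_
_⊛_ : {E : Set} → FormalSum (List E) → FormalSum (List E) → FormalSum (List E)
p ⊛ p' = concatMap (λ t → map (λ t' → proj₁ t * proj₁ t' , proj₂ t ++ proj₂ t') p') p

eval-⊛ : {E : Set} (H : List E → ℚ) (p p' : FormalSum (List E)) →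
         eval H (p ⊛ p') ≡ eval (λ u → eval (λ u' → H (u ++ u')) p') p
eval-⊛ H p p' = trans (∑-concatMap _ _ p) (∑-cong (λ t → trans (∑-map _ _ p')
  (trans (∑-cong (λ t' → ℚ.*-assoc (proj₁ t) (proj₁ t') _) p') (∑-*ˡ (proj₁ t) _ p'))) p)

eval-single : {X : Set} (H : X → ℚ) (x : X) → eval H ((1ℚ , x) ∷ []) ≡ H x
eval-single H x = trans (ℚ.+-identityʳ _) (ℚ.*-identityˡ (H x))

eval-bind-single : {X Y : Set} (H : Y → ℚ) (L : X → FormalSum Y) (x : X) →
                   eval H (bind L ((1ℚ , x) ∷ [])) ≡ eval H (L x)
eval-bind-single H L x = trans (eval-bind H L ((1ℚ , x) ∷ [])) (eval-single (λ x → eval H (L x)) x)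

eval-bind-pair : {X Y : Set} (H : Y → ℚ) (L : X → FormalSum Y) (x y : X) →
                 eval H (bind L ((1ℚ , x) ∷ (1ℚ , y) ∷ [])) ≡ eval H (L x) + eval H (L y)
eval-bind-pair H L x y = trans (eval-bind H L ((1ℚ , x) ∷ (1ℚ , y) ∷ []))
                               (cong₂ _+_ (ℚ.*-identityˡ (eval H (L x))) (eval-single (λ x → eval H (L x)) y))

unit : {E : Set} → FormalSum (List E)
unit = (1ℚ , []) ∷ []

eval-⊛-unitˡ : {E : Set} (H : List E → ℚ) (p : FormalSum (List E)) → eval H (unit ⊛ p) ≡ eval H p
eval-⊛-unitˡ H p = trans (eval-⊛ H unit p) (eval-single (λ u → eval (λ u' → H (u ++ u')) p) [])

eval-⊛-unitʳ : {E : Set} (H : List E → ℚ) (p : FormalSum (List E)) → eval H (p ⊛ unit) ≡ eval H p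
eval-⊛-unitʳ H p = trans (eval-⊛ H p unit) (eval-cong (λ u → right-unit u) p)
  where
  right-unit : ∀ u → eval (λ u' → H (u ++ u')) unit ≡ H u
  right-unit u = trans (eval-single (λ u' → H (u ++ u')) []) (cong H (++-identityʳ u))

module _ {X E : Set} (L : X → FormalSum (List E)) (P : X → X → FormalSum X)
         (L-⊛ : ∀ A B H → eval H (L A ⊛ L B) ≡ eval H (bind L (P A B))) where

  eval-bind-⊛ : ∀ f g (H : List E → ℚ) →
                eval H (bind L f ⊛ bind L g) ≡ eval H (bind L (bind (λ A → bind (P A) g) f))
  eval-bind-⊛ f g H = begin
    eval H (bind L f ⊛ bind L g)
      ≡⟨ eval-⊛ H (bind L f) (bind L g) ⟩
    eval (λ u → eval (λ u' → H (u ++ u')) (bind L g)) (bind L f)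
      ≡⟨ eval-bind _ L f ⟩
    eval (λ A → eval (λ u → eval (λ u' → H (u ++ u')) (bind L g)) (L A)) f
      ≡⟨ eval-cong (λ A → eval-cong (λ u → eval-bind _ L g) (L A)) f ⟩
    eval (λ A → eval (λ u → eval (λ B → eval (λ u' → H (u ++ u')) (L B)) g) (L A)) f
      ≡⟨ eval-cong (λ A → eval-swap _ (L A) g) f ⟩
    eval (λ A → eval (λ B → eval (λ u → eval (λ u' → H (u ++ u')) (L B)) (L A)) g) f
      ≡⟨ eval-cong (λ A → eval-cong (λ B → begin
           eval (λ u → eval (λ u' → H (u ++ u')) (L B)) (L A) ≡⟨ sym (eval-⊛ H (L A) (L B)) ⟩
           eval H (L A ⊛ L B)                                 ≡⟨ L-⊛ A B H ⟩
           eval H (bind L (P A B))                            ≡⟨ eval-bind H L (P A B) ⟩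
           eval (λ C → eval H (L C)) (P A B)                  ∎) g) f ⟩
    eval (λ A → eval (λ B → eval (λ C → eval H (L C)) (P A B)) g) f
      ≡⟨ sym (eval-cong (λ A → eval-bind _ (P A) g) f) ⟩
    eval (λ A → eval (λ C → eval H (L C)) (bind (P A) g)) f
      ≡⟨ sym (eval-bind _ (λ A → bind (P A) g) f) ⟩
    eval (λ C → eval H (L C)) (bind (λ A → bind (P A) g) f)
      ≡⟨ sym (eval-bind H L (bind (λ A → bind (P A) g) f)) ⟩
    eval H (bind L (bind (λ A → bind (P A) g) f)) ∎

𝟙 : Bool → ℚ
𝟙 b = if b then 1ℚ else 0ℚ

if-then-0 : ∀ b q → (if b then q else 0ℚ) ≡ q * 𝟙 b
if-then-0 true  q = sym (ℚ.*-identityʳ q)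
if-then-0 false q = sym (ℚ.*-zeroʳ q)

module Coefficients {X : Set} (_≟_ : DecidableEquality X) where

  δ : X → X → ℚ
  δ x y = 𝟙 (does (x ≟ y))

  coeff : FormalSum X → X → ℚ
  coeff p y = eval (λ x → δ x y) p

  δ-refl : ∀ x → δ x x ≡ 1ℚ
  δ-refl x = cong 𝟙 (dec-true (x ≟ x) refl)

  δ-≢ : ∀ {x y} → x ≢ y → δ x y ≡ 0ℚ
  δ-≢ {x} {y} x≢y = cong 𝟙 (dec-false (x ≟ y) x≢y)

  removeKey : X → FormalSum X → FormalSum X
  removeKey x = filter (λ t → ¬? (proj₂ t ≟ x))

  length-removeKey-∷ : ∀ x q p → length (removeKey x ((q , x) ∷ p)) ≤ length p
  length-removeKey-∷ x q p with x ≟ x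
  ... | yes _ = length-filter _ p
  ... | no x≢x = ⊥-elim (x≢x refl)

  eval-removeKey : (H : X → ℚ) (x : X) (p : FormalSum X) →
                   eval H p ≡ coeff p x * H x + eval H (removeKey x p)
  eval-removeKey H x [] = solve 1 (λ h → con 0ℚ := con 0ℚ :* h :+ con 0ℚ) refl (H x)
  eval-removeKey H x ((q , y) ∷ p) with y ≟ x | eval-removeKey H x p
  ... | yes refl | ih = trans (cong (q * H y +_) ih)
    (solve 4 (λ q h c r → q :* h :+ (c :* h :+ r) := (q :* con 1ℚ :+ c) :* h :+ r) refl q (H y) _ _)
  ... | no _     | ih = trans (cong (q * H y +_) ih)
    (solve 5 (λ q hy h c r → q :* hy :+ (c :* h :+ r) := (q :* con 0ℚ :+ c) :* h :+ (q :* hy :+ r)) refl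
       q (H y) (H x) _ _)

  coeff-removeKey : ∀ x p y → coeff (removeKey x p) y ≡ coeff p y - coeff p x * δ x y
  coeff-removeKey x p y = begin
    r                ≡⟨ solve 2 (λ a r → r := (a :+ r) :+ :- a) refl (coeff p x * δ x y) r ⟩
    (a + r) - a      ≡⟨ cong (_- a) (sym (eval-removeKey (λ z → δ z y) x p)) ⟩
    coeff p y - a    ∎
    where
    a = coeff p x * δ x y
    r = coeff (removeKey x p) y

  eval-null : (H : X → ℚ) (p : FormalSum X) → (∀ x → coeff p x ≡ 0ℚ) → eval H p ≡ 0ℚ
  eval-null H p = go (length p) p ℕ.≤-refl
    where
    go : ∀ n p → length p ≤ n → (∀ x → coeff p x ≡ 0ℚ) → eval H p ≡ 0ℚ
    go _       []            _         _    = refl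
    go (suc n) ((q , x) ∷ p) (s≤s |p|≤n) null = begin
      eval H ((q , x) ∷ p)
        ≡⟨ eval-removeKey H x ((q , x) ∷ p) ⟩
      coeff ((q , x) ∷ p) x * H x + eval H (removeKey x ((q , x) ∷ p))
        ≡⟨ cong₂ (λ c r → c * H x + r) (null x)
                 (go n (removeKey x ((q , x) ∷ p)) (ℕ.≤-trans (length-removeKey-∷ x q p) |p|≤n) null′) ⟩
      0ℚ * H x + 0ℚ
        ≡⟨ solve 1 (λ h → con 0ℚ :* h :+ con 0ℚ := con 0ℚ) refl (H x) ⟩
      0ℚ ∎
      where
      null′ : ∀ y → coeff (removeKey x ((q , x) ∷ p)) y ≡ 0ℚ
      null′ y = begin
        coeff (removeKey x ((q , x) ∷ p)) y
          ≡⟨ coeff-removeKey x ((q , x) ∷ p) y ⟩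
        coeff ((q , x) ∷ p) y - coeff ((q , x) ∷ p) x * δ x y
          ≡⟨ cong₂ (λ a b → a - b * δ x y) (null y) (null x) ⟩
        0ℚ - 0ℚ * δ x y
          ≡⟨ solve 1 (λ d → con 0ℚ :+ :- (con 0ℚ :* d) := con 0ℚ) refl (δ x y) ⟩
        0ℚ ∎

  eval-cong-coeff : (H : X → ℚ) (p p' : FormalSum X) → (∀ x → coeff p x ≡ coeff p' x) → eval H p ≡ eval H p'
  eval-cong-coeff H p p' same = begin
    eval H p                                   ≡⟨ solve 2 (λ a b → a := (a :+ con (- 1ℚ) :* b) :+ b) refl
                                                          (eval H p) (eval H p') ⟩
    (eval H p + - 1ℚ * eval H p') + eval H p'  ≡⟨ cong (_+ eval H p') (sym (eval-difference H)) ⟩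
    eval H d + eval H p'                       ≡⟨ cong (_+ eval H p') (eval-null H d d-null) ⟩
    0ℚ + eval H p'                             ≡⟨ ℚ.+-identityˡ _ ⟩
    eval H p'                                  ∎
    where
    d = p ++ scale (- 1ℚ) p'

    eval-difference : (G : X → ℚ) → eval G d ≡ eval G p + - 1ℚ * eval G p'
    eval-difference G = trans (∑-++ _ p _) (cong (eval G p +_) (eval-scale G (- 1ℚ) p'))

    d-null : ∀ x → coeff d x ≡ 0ℚ
    d-null x = begin
      coeff d x                       ≡⟨ eval-difference (λ y → δ y x) ⟩
      coeff p x + - 1ℚ * coeff p' x   ≡⟨ cong (_+ - 1ℚ * coeff p' x) (same x) ⟩
      coeff p' x + - 1ℚ * coeff p' x  ≡⟨ solve 1 (λ c → c :+ con (- 1ℚ) :* c := con 0ℚ) refl (coeff p' x) ⟩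
      0ℚ                              ∎

module W = Coefficients (≡-dec _≟B_)
module N = Coefficients (≡-dec ℕ._≟_)

coeffP-eval : ∀ p w → coeffP p w ≡ W.coeff p w
coeffP-eval []            w = refl
coeffP-eval ((q , u) ∷ p) w = cong₂ _+_ (if-then-0 _ q) (coeffP-eval p w)

coeffN-eval : ∀ y α → coeffN y α ≡ N.coeff y α
coeffN-eval []            α = refl
coeffN-eval ((q , β) ∷ y) α = cong₂ _+_ (if-then-0 _ q) (coeffN-eval y α)

≈P⇒eval≡ : (H : Word → ℚ) (p p' : Poly) → p ≈P p' → eval H p ≡ eval H p'
≈P⇒eval≡ H p p' p≈p' = W.eval-cong-coeff H p p' λ w →
  trans (sym (coeffP-eval p w)) (trans (p≈p' w) (coeffP-eval p' w))

≈N⇒eval≡ : (H : Comp → ℚ) (y y' : NSym) → y ≈N y' → eval H y ≡ eval H y'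
≈N⇒eval≡ H y y' y≈y' = N.eval-cong-coeff H y y' λ α →
  trans (sym (coeffN-eval y α)) (trans (y≈y' α) (coeffN-eval y' α))

eval≡⇒≈P : ∀ p p' → (∀ (H : Word → ℚ) → eval H p ≡ eval H p') → p ≈P p'
eval≡⇒≈P p p' same w = trans (coeffP-eval p w) (trans (same (λ u → W.δ u w)) (sym (coeffP-eval p' w)))

eval≡⇒≈N : ∀ y y' → (∀ (Φ : Comp → ℚ) → eval Φ y ≡ eval Φ y') → y ≈N y'
eval≡⇒≈N y y' same α = trans (coeffN-eval y α) (trans (same (λ β → N.δ β α)) (sym (coeffN-eval y' α)))

-- Coarsenings and ribbon Schur functions

addToFirst : ℕ → Comp → Comp
addToFirst a []      = a ∷ []
addToFirst a (b ∷ β) = a +ℕ b ∷ β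

infixr 5 _⊙_
_⊙_ : Comp → Comp → Comp
[]          ⊙ β = β
(a ∷ [])    ⊙ β = addToFirst a β
(a ∷ b ∷ α) ⊙ β = a ∷ (b ∷ α) ⊙ β

coarsenings-length≤ : ∀ a r → All (λ β → length β ≤ suc (length r)) (coarsenings (a ∷ r))
coarsenings-length≤ a []      = s≤s z≤n ∷ []
coarsenings-length≤ a (b ∷ r) = ++⁺ (map⁺ (All.map s≤s (coarsenings-length≤ b r)))
                                    (All.map ℕ.m≤n⇒m≤1+n (coarsenings-length≤ (a +ℕ b) r))

∑-coarsenings-∷∷ : ∀ a b r (F : Comp → ℚ) → ∑ (coarsenings (a ∷ b ∷ r)) F ≡
                   ∑[ β ← coarsenings (b ∷ r) ] F (a ∷ β) + ∑ (coarsenings (a +ℕ b ∷ r)) F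
∑-coarsenings-∷∷ a b r F = trans (∑-++ F (map (a ∷_) (coarsFrom b r)) _)
                                 (cong (_+ ∑ (coarsFrom (a +ℕ b) r) F) (∑-map F (a ∷_) (coarsFrom b r)))

eval-ribbon-∷∷ : ∀ a b r (F : Comp → ℚ) → eval F (ribbon (a ∷ b ∷ r)) ≡
                 eval (λ β → F (a ∷ β)) (ribbon (b ∷ r)) - eval F (ribbon (a +ℕ b ∷ r))
eval-ribbon-∷∷ a b r F = begin
  eval F (ribbon (a ∷ b ∷ r))
    ≡⟨ ∑-map _ _ (coarsenings (a ∷ b ∷ r)) ⟩
  ∑[ β ← coarsenings (a ∷ b ∷ r) ] (sgn (2 +ℕ length r ∸ length β) * F β)
    ≡⟨ ∑-coarsenings-∷∷ a b r _ ⟩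
  ∑[ β ← coarsenings (b ∷ r) ] (sgn (1 +ℕ length r ∸ length β) * F (a ∷ β))
    + ∑[ β ← coarsenings (a +ℕ b ∷ r) ] (sgn (2 +ℕ length r ∸ length β) * F β)
    ≡⟨ cong₂ _+_ (sym (∑-map _ _ (coarsenings (b ∷ r)))) signs ⟩
  eval (λ β → F (a ∷ β)) (ribbon (b ∷ r)) - eval F (ribbon (a +ℕ b ∷ r)) ∎
  where
  -- ℓ(β) ≤ ℓ(r) + 1, so the truncated subtraction in the sign is exact.
  signs : ∑[ β ← coarsenings (a +ℕ b ∷ r) ] (sgn (2 +ℕ length r ∸ length β) * F β)
          ≡ - eval F (ribbon (a +ℕ b ∷ r))
  signs = begin
    ∑[ β ← coarsenings (a +ℕ b ∷ r) ] (sgn (2 +ℕ length r ∸ length β) * F β)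
      ≡⟨ ∑-congAll _ (All.map (λ {β} |β|≤ → trans (cong (λ k → sgn k * F β) (ℕ.+-∸-assoc 1 |β|≤))
                                                    (sym (ℚ.neg-distribˡ-* (sgn (1 +ℕ length r ∸ length β)) (F β))))
                              (coarsenings-length≤ (a +ℕ b) r)) ⟩
    ∑[ β ← coarsenings (a +ℕ b ∷ r) ] (- (sgn (1 +ℕ length r ∸ length β) * F β))
      ≡⟨ ∑-neg _ (coarsenings (a +ℕ b ∷ r)) ⟩
    - ∑[ β ← coarsenings (a +ℕ b ∷ r) ] (sgn (1 +ℕ length r ∸ length β) * F β)
      ≡⟨ cong -_ (sym (∑-map _ _ (coarsenings (a +ℕ b ∷ r)))) ⟩
    - eval F (ribbon (a +ℕ b ∷ r)) ∎

∑-coarsenings-cong : ∀ a r {F G : Comp → ℚ} → (∀ b β → F (b ∷ β) ≡ G (b ∷ β)) →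
                     ∑ (coarsenings (a ∷ r)) F ≡ ∑ (coarsenings (a ∷ r)) G
∑-coarsenings-cong a []      F≗G = cong (_+ 0ℚ) (F≗G a [])
∑-coarsenings-cong a (b ∷ r) {F} {G} F≗G = begin
  ∑ (coarsenings (a ∷ b ∷ r)) F
    ≡⟨ ∑-coarsenings-∷∷ a b r F ⟩
  ∑[ β ← coarsenings (b ∷ r) ] F (a ∷ β) + ∑ (coarsenings (a +ℕ b ∷ r)) F
    ≡⟨ cong₂ _+_ (∑-cong (F≗G a) (coarsenings (b ∷ r))) (∑-coarsenings-cong (a +ℕ b) r F≗G) ⟩
  ∑[ β ← coarsenings (b ∷ r) ] G (a ∷ β) + ∑ (coarsenings (a +ℕ b ∷ r)) G
    ≡⟨ sym (∑-coarsenings-∷∷ a b r G) ⟩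
  ∑ (coarsenings (a ∷ b ∷ r)) G ∎

eval-ribbon-cong : ∀ a r {F G : Comp → ℚ} → (∀ b β → F (b ∷ β) ≡ G (b ∷ β)) →
                   eval F (ribbon (a ∷ r)) ≡ eval G (ribbon (a ∷ r))
eval-ribbon-cong a []      F≗G = cong (λ x → 1ℚ * x + 0ℚ) (F≗G a [])
eval-ribbon-cong a (b ∷ r) {F} {G} F≗G = begin
  eval F (ribbon (a ∷ b ∷ r))
    ≡⟨ eval-ribbon-∷∷ a b r F ⟩
  eval (λ β → F (a ∷ β)) (ribbon (b ∷ r)) - eval F (ribbon (a +ℕ b ∷ r))
    ≡⟨ cong₂ _-_ (eval-cong (F≗G a) (ribbon (b ∷ r))) (eval-ribbon-cong (a +ℕ b) r F≗G) ⟩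
  eval (λ β → G (a ∷ β)) (ribbon (b ∷ r)) - eval G (ribbon (a +ℕ b ∷ r))
    ≡⟨ sym (eval-ribbon-∷∷ a b r G) ⟩
  eval G (ribbon (a ∷ b ∷ r)) ∎

∑-coarsenings-addToFirst : ∀ a b r (F : Comp → ℚ) →
  ∑[ β ← coarsenings (b ∷ r) ] F (addToFirst a β) ≡ ∑ (coarsenings (a +ℕ b ∷ r)) F
∑-coarsenings-addToFirst a b []      F = refl
∑-coarsenings-addToFirst a b (c ∷ r) F = begin
  ∑[ β ← coarsenings (b ∷ c ∷ r) ] F (addToFirst a β)
    ≡⟨ ∑-coarsenings-∷∷ b c r _ ⟩
  ∑[ β ← coarsenings (c ∷ r) ] F (a +ℕ b ∷ β) + ∑[ β ← coarsenings (b +ℕ c ∷ r) ] F (addToFirst a β)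
    ≡⟨ cong (∑[ β ← coarsenings (c ∷ r) ] F (a +ℕ b ∷ β) +_)
            (trans (∑-coarsenings-addToFirst a (b +ℕ c) r F)
                   (cong (λ n → ∑ (coarsenings (n ∷ r)) F) (sym (ℕ.+-assoc a b c)))) ⟩
  ∑[ β ← coarsenings (c ∷ r) ] F (a +ℕ b ∷ β) + ∑ (coarsenings (a +ℕ b +ℕ c ∷ r)) F
    ≡⟨ sym (∑-coarsenings-∷∷ (a +ℕ b) c r F) ⟩
  ∑ (coarsenings (a +ℕ b ∷ c ∷ r)) F ∎

eval-ribbon-addToFirst : ∀ a b r (F : Comp → ℚ) →
  eval (λ β → F (addToFirst a β)) (ribbon (b ∷ r)) ≡ eval F (ribbon (a +ℕ b ∷ r))
eval-ribbon-addToFirst a b []      F = refl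
eval-ribbon-addToFirst a b (c ∷ r) F = begin
  eval (λ β → F (addToFirst a β)) (ribbon (b ∷ c ∷ r))
    ≡⟨ eval-ribbon-∷∷ b c r _ ⟩
  eval (λ β → F (a +ℕ b ∷ β)) (ribbon (c ∷ r)) - eval (λ β → F (addToFirst a β)) (ribbon (b +ℕ c ∷ r))
    ≡⟨ cong (λ x → eval (λ β → F (a +ℕ b ∷ β)) (ribbon (c ∷ r)) - x)
            (trans (eval-ribbon-addToFirst a (b +ℕ c) r F)
                   (cong (λ n → eval F (ribbon (n ∷ r))) (sym (ℕ.+-assoc a b c)))) ⟩
  eval (λ β → F (a +ℕ b ∷ β)) (ribbon (c ∷ r)) - eval F (ribbon (a +ℕ b +ℕ c ∷ r))
    ≡⟨ sym (eval-ribbon-∷∷ (a +ℕ b) c r F) ⟩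
  eval F (ribbon (a +ℕ b ∷ c ∷ r)) ∎

eval-ribbon-∑coarsenings : ∀ γ (G : Comp → ℚ) → eval (λ β → ∑ (coarsenings β) G) (ribbon γ) ≡ G γ
eval-ribbon-∑coarsenings []          G = trans (eval-single (λ β → ∑ (coarsenings β) G) []) (ℚ.+-identityʳ (G []))
eval-ribbon-∑coarsenings (a ∷ [])    G =
  trans (eval-single (λ β → ∑ (coarsenings β) G) (a ∷ [])) (ℚ.+-identityʳ (G (a ∷ [])))
eval-ribbon-∑coarsenings (a ∷ b ∷ r) G = begin
  eval Φ (ribbon (a ∷ b ∷ r))
    ≡⟨ eval-ribbon-∷∷ a b r Φ ⟩
  eval (λ β → Φ (a ∷ β)) (ribbon (b ∷ r)) - eval Φ (ribbon (a +ℕ b ∷ r))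
    ≡⟨ cong (_- eval Φ (ribbon (a +ℕ b ∷ r)))
            (trans (eval-ribbon-cong b r (λ x xs → ∑-coarsenings-∷∷ a x xs G)) (eval-+ _ _ (ribbon (b ∷ r)))) ⟩
  (eval (λ β → ∑ (coarsenings β) (λ δ → G (a ∷ δ))) (ribbon (b ∷ r))
    + eval (λ β → Φ (addToFirst a β)) (ribbon (b ∷ r))) - eval Φ (ribbon (a +ℕ b ∷ r))
    ≡⟨ cong₂ (λ x y → x + y - eval Φ (ribbon (a +ℕ b ∷ r)))
             (eval-ribbon-∑coarsenings (b ∷ r) (λ δ → G (a ∷ δ))) (eval-ribbon-addToFirst a b r Φ) ⟩
  G (a ∷ b ∷ r) + eval Φ (ribbon (a +ℕ b ∷ r)) - eval Φ (ribbon (a +ℕ b ∷ r))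
    ≡⟨ p+q-q≡p _ _ ⟩
  G (a ∷ b ∷ r) ∎
  where
  Φ : Comp → ℚ
  Φ β = ∑ (coarsenings β) G

∑coarsenings-eval-ribbon : ∀ γ (F : Comp → ℚ) → ∑[ β ← coarsenings γ ] eval F (ribbon β) ≡ F γ
∑coarsenings-eval-ribbon []          F = trans (ℚ.+-identityʳ _) (eval-single F [])
∑coarsenings-eval-ribbon (a ∷ [])    F = trans (ℚ.+-identityʳ _) (eval-single F (a ∷ []))
∑coarsenings-eval-ribbon (a ∷ b ∷ r) F = begin
  ∑ (coarsenings (a ∷ b ∷ r)) Ψ
    ≡⟨ ∑-coarsenings-∷∷ a b r Ψ ⟩
  ∑[ β ← coarsenings (b ∷ r) ] Ψ (a ∷ β) + ∑ (coarsenings (a +ℕ b ∷ r)) Ψ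
    ≡⟨ cong (_+ ∑ (coarsenings (a +ℕ b ∷ r)) Ψ)
            (trans (∑-coarsenings-cong b r (λ x xs → eval-ribbon-∷∷ a x xs F))
                   (∑-sub _ _ (coarsenings (b ∷ r)))) ⟩
  (∑[ β ← coarsenings (b ∷ r) ] eval (λ δ → F (a ∷ δ)) (ribbon β)
    - ∑[ β ← coarsenings (b ∷ r) ] Ψ (addToFirst a β)) + ∑ (coarsenings (a +ℕ b ∷ r)) Ψ
    ≡⟨ cong₂ (λ x y → x - y + ∑ (coarsenings (a +ℕ b ∷ r)) Ψ)
             (∑coarsenings-eval-ribbon (b ∷ r) (λ δ → F (a ∷ δ))) (∑-coarsenings-addToFirst a b r Ψ) ⟩
  F (a ∷ b ∷ r) - ∑ (coarsenings (a +ℕ b ∷ r)) Ψ + ∑ (coarsenings (a +ℕ b ∷ r)) Ψ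
    ≡⟨ p-q+q≡p _ _ ⟩
  F (a ∷ b ∷ r) ∎
  where
  Ψ : Comp → ℚ
  Ψ β = eval F (ribbon β)

eval-ribbon-∷⊙ : ∀ a b r d s (F : Comp → ℚ) →
  eval F (ribbon ((a ∷ b ∷ r) ⊙ (d ∷ s))) ≡
  eval (λ β → F (a ∷ β)) (ribbon ((b ∷ r) ⊙ (d ∷ s))) - eval F (ribbon ((a +ℕ b ∷ r) ⊙ (d ∷ s)))
eval-ribbon-∷⊙ a b []      d s F rewrite ℕ.+-assoc a b d = eval-ribbon-∷∷ a (b +ℕ d) s F
eval-ribbon-∷⊙ a b (c ∷ r) d s F = eval-ribbon-∷∷ a b ((c ∷ r) ⊙ (d ∷ s)) F

eval-ribbon-⊛ : ∀ a r d s (F : Comp → ℚ) →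
  eval F (ribbon (a ∷ r) ⊛ ribbon (d ∷ s)) ≡
  eval F (ribbon ((a ∷ r) ++ (d ∷ s))) + eval F (ribbon ((a ∷ r) ⊙ (d ∷ s)))
eval-ribbon-⊛ a r d s F = trans (eval-⊛ F (ribbon (a ∷ r)) (ribbon (d ∷ s))) (expand a r F)
  where
  expand : ∀ a r (F : Comp → ℚ) →
    eval (λ β → eval (λ β' → F (β ++ β')) (ribbon (d ∷ s))) (ribbon (a ∷ r)) ≡
    eval F (ribbon ((a ∷ r) ++ (d ∷ s))) + eval F (ribbon ((a ∷ r) ⊙ (d ∷ s)))
  expand a [] F = begin
    1ℚ * Y + 0ℚ   ≡⟨ solve 2 (λ y x → con 1ℚ :* y :+ con 0ℚ := y :+ :- x :+ x) refl Y X ⟩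
    Y - X + X     ≡⟨ cong (_+ X) (sym (eval-ribbon-∷∷ a d s F)) ⟩
    eval F (ribbon (a ∷ d ∷ s)) + X ∎
    where
    Y = eval (λ β → F (a ∷ β)) (ribbon (d ∷ s))
    X = eval F (ribbon (a +ℕ d ∷ s))
  expand a (b ∷ r) F = begin
    eval Φ (ribbon (a ∷ b ∷ r))
      ≡⟨ eval-ribbon-∷∷ a b r Φ ⟩
    eval (λ β → Φ (a ∷ β)) (ribbon (b ∷ r)) - eval Φ (ribbon (a +ℕ b ∷ r))
      ≡⟨ cong₂ _-_ (expand b r (λ β → F (a ∷ β))) (expand (a +ℕ b) r F) ⟩
    (P + Q) - (R + S)
      ≡⟨ [p+q]-[r+s]≡[p-r]+[q-s] P Q R S ⟩
    (P - R) + (Q - S)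
      ≡⟨ cong₂ _+_ (sym (eval-ribbon-∷∷ a b (r ++ d ∷ s) F)) (sym (eval-ribbon-∷⊙ a b r d s F)) ⟩
    eval F (ribbon ((a ∷ b ∷ r) ++ (d ∷ s))) + eval F (ribbon ((a ∷ b ∷ r) ⊙ (d ∷ s))) ∎
    where
    Φ : Comp → ℚ
    Φ β = eval (λ β' → F (β ++ β')) (ribbon (d ∷ s))
    P = eval (λ β → F (a ∷ β)) (ribbon ((b ∷ r) ++ (d ∷ s)))
    Q = eval (λ β → F (a ∷ β)) (ribbon ((b ∷ r) ⊙ (d ∷ s)))
    R = eval F (ribbon ((a +ℕ b ∷ r) ++ (d ∷ s)))
    S = eval F (ribbon ((a +ℕ b ∷ r) ⊙ (d ∷ s)))

coarsenings-valid : ∀ β → All (1 ≤_) β → All (All (1 ≤_)) (coarsenings β)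
coarsenings-valid []      []              = [] ∷ []
coarsenings-valid (a ∷ r) (1≤a ∷ valid) = go a r 1≤a valid
  where
  go : ∀ a r → 1 ≤ a → All (1 ≤_) r → All (All (1 ≤_)) (coarsenings (a ∷ r))
  go a []      1≤a []              = (1≤a ∷ []) ∷ []
  go a (b ∷ r) 1≤a (1≤b ∷ valid) = ++⁺ (map⁺ (All.map (1≤a ∷_) (go b r 1≤b valid)))
                                        (go (a +ℕ b) r (ℕ.≤-trans 1≤a (ℕ.m≤m+n a b)) valid)

-- Words and the monomials m_A

flipWord : Word → Word
flipWord = map not

flipWord-involutive : ∀ w → flipWord (flipWord w) ≡ w
flipWord-involutive w = trans (sym (map-∘ w)) (trans (map-cong not-involutive w) (map-id w))

pattern⇒relabel : ∀ x y x' y' → eqB (eqB x x') (eqB y y') ≡ true → x' ≡ eqB (eqB x y) y'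
pattern⇒relabel false false false false _ = refl
pattern⇒relabel false false false true  ()
pattern⇒relabel false false true  false ()
pattern⇒relabel false false true  true  _ = refl
pattern⇒relabel false true  false false ()
pattern⇒relabel false true  false true  _ = refl
pattern⇒relabel false true  true  false _ = refl
pattern⇒relabel false true  true  true  ()
pattern⇒relabel true  false false false ()
pattern⇒relabel true  false false true  _ = refl
pattern⇒relabel true  false true  false _ = refl
pattern⇒relabel true  false true  true  ()
pattern⇒relabel true  true  false false _ = refl
pattern⇒relabel true  true  false true  ()
pattern⇒relabel true  true  true  false ()
pattern⇒relabel true  true  true  true  _ = refl

allB-zipL-map : ∀ (f : Bool → Bool) (P : Bool × Bool → Bool) A →
                (∀ y → P (f y , y) ≡ true) → allB P (zipL (map f A) A) ≡ true
allB-zipL-map f P []      _ = refl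
allB-zipL-map f P (y ∷ A) P≡true rewrite P≡true y = allB-zipL-map f P A P≡true

samePattern-map : ∀ (f : Bool → Bool) → (∀ y y' → eqB (eqB (f y) (f y')) (eqB y y') ≡ true) →
                  ∀ A → samePattern (map f A) A ≡ true
samePattern-map f f-pattern A =
  allB-zipL-map f _ A λ y → allB-zipL-map f _ A λ y' → f-pattern y y'

samePattern-refl : ∀ A → samePattern A A ≡ true
samePattern-refl A = subst (λ u → samePattern u A ≡ true) (map-id A) (samePattern-map (λ b → b) id-pattern A)
  where
  id-pattern : ∀ y y' → eqB (eqB y y') (eqB y y') ≡ true
  id-pattern false false = refl
  id-pattern false true  = refl
  id-pattern true  false = refl
  id-pattern true  true  = refl

samePattern-flip : ∀ A → samePattern (flipWord A) A ≡ true
samePattern-flip = samePattern-map not not-pattern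
  where
  not-pattern : ∀ y y' → eqB (eqB (not y) (not y')) (eqB y y') ≡ true
  not-pattern false false = refl
  not-pattern false true  = refl
  not-pattern true  false = refl
  not-pattern true  true  = refl

∧-trueˡ : ∀ {a b} → a ∧ b ≡ true → a ≡ true
∧-trueˡ {true} _ = refl

∧-trueʳ : ∀ {a b} → a ∧ b ≡ true → b ≡ true
∧-trueʳ {true} b≡true = b≡true

allB-pattern⇒relabel : ∀ x y u A → length u ≡ length A →
                  allB (λ q → eqB (eqB x (proj₁ q)) (eqB y (proj₂ q))) (zipL u A) ≡ true →
                  u ≡ map (eqB (eqB x y)) A
allB-pattern⇒relabel x y []       []       _     _ = refl
allB-pattern⇒relabel x y (x' ∷ u) (y' ∷ A) |u|≡|A| h =
  cong₂ _∷_ (pattern⇒relabel x y x' y' (∧-trueˡ h))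
            (allB-pattern⇒relabel x y u A (ℕ.suc-injective |u|≡|A|) (∧-trueʳ h))

relabel-cases : ∀ c w → (map (eqB c) w ≡ w) ⊎ (map (eqB c) w ≡ flipWord w)
relabel-cases true  w = inj₁ (trans (map-cong (λ { false → refl ; true → refl }) w) (map-id w))
relabel-cases false w = inj₂ (map-cong (λ { false → refl ; true → refl }) w)

samePattern⇒≡⊎≡flip : ∀ u A → length u ≡ length A → samePattern u A ≡ true →
                      (u ≡ A) ⊎ (u ≡ flipWord A)
samePattern⇒≡⊎≡flip []      []      _      _    = inj₁ refl
samePattern⇒≡⊎≡flip (x ∷ u) (y ∷ A) |u|≡|A| same
  rewrite allB-pattern⇒relabel x y (x ∷ u) (y ∷ A) |u|≡|A| (∧-trueˡ same) = relabel-cases (eqB x y) (y ∷ A)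

𝟙-samePattern : ∀ A u → length u ≡ suc (length A) →
  𝟙 (does (samePattern u (false ∷ A) ≟ true)) ≡ W.δ u (false ∷ A) + W.δ u (flipWord (false ∷ A))
𝟙-samePattern A u |u| with samePattern u (false ∷ A) ≟ true
... | yes same with samePattern⇒≡⊎≡flip u (false ∷ A) |u| same
...   | inj₁ refl = trans (sym (ℚ.+-identityʳ 1ℚ)) (cong (_+ 0ℚ) (sym (W.δ-refl (false ∷ A))))
...   | inj₂ refl = trans (sym (ℚ.+-identityˡ 1ℚ)) (cong (0ℚ +_) (sym (W.δ-refl (flipWord (false ∷ A)))))
𝟙-samePattern A u |u| | no different = sym (cong₂ _+_
  (W.δ-≢ {u} {false ∷ A} λ { refl → different (samePattern-refl (false ∷ A)) })
  (W.δ-≢ {u} {flipWord (false ∷ A)} λ { refl → different (samePattern-flip (false ∷ A)) }))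

allWords-length : ∀ n → All (λ u → length u ≡ n) (allWords n)
allWords-length zero    = refl ∷ []
allWords-length (suc n) = concat⁺ (map⁺ (All.map (λ |u| → cong suc |u| ∷ cong suc |u| ∷ []) (allWords-length n)))

∑-allWords-δ : ∀ n A (H : Word → ℚ) → length A ≡ n → ∑[ u ← allWords n ] (W.δ u A * H u) ≡ H A
∑-allWords-δ zero    []      H refl = solve 1 (λ h → con 1ℚ :* h :+ con 0ℚ := h) refl (H [])
∑-allWords-δ (suc n) (false ∷ A) H |A| = begin
  ∑[ u ← allWords (suc n) ] (W.δ u (false ∷ A) * H u)
    ≡⟨ ∑-concatMap _ _ (allWords n) ⟩
  ∑[ u ← allWords n ] (W.δ u A * H (false ∷ u) + (0ℚ * H (true ∷ u) + 0ℚ))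
    ≡⟨ ∑-cong (λ u → solve 2 (λ x y → x :+ (con 0ℚ :* y :+ con 0ℚ) := x) refl
                              (W.δ u A * H (false ∷ u)) (H (true ∷ u))) (allWords n) ⟩
  ∑[ u ← allWords n ] (W.δ u A * H (false ∷ u))
    ≡⟨ ∑-allWords-δ n A (λ u → H (false ∷ u)) (ℕ.suc-injective |A|) ⟩
  H (false ∷ A) ∎
∑-allWords-δ (suc n) (true ∷ A) H |A| = begin
  ∑[ u ← allWords (suc n) ] (W.δ u (true ∷ A) * H u)
    ≡⟨ ∑-concatMap _ _ (allWords n) ⟩
  ∑[ u ← allWords n ] (0ℚ * H (false ∷ u) + (W.δ u A * H (true ∷ u) + 0ℚ))
    ≡⟨ ∑-cong (λ u → solve 2 (λ x y → con 0ℚ :* y :+ (x :+ con 0ℚ) := x) refl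
                              (W.δ u A * H (true ∷ u)) (H (false ∷ u))) (allWords n) ⟩
  ∑[ u ← allWords n ] (W.δ u A * H (true ∷ u))
    ≡⟨ ∑-allWords-δ n A (λ u → H (true ∷ u)) (ℕ.suc-injective |A|) ⟩
  H (true ∷ A) ∎

eval-filter : {X : Set} {P : X → Set} (P? : Decidable P) (H : X → ℚ) (xs : List X) →
              eval H (map (λ x → 1ℚ , x) (filter P? xs)) ≡ ∑[ x ← xs ] (𝟙 (does (P? x)) * H x)
eval-filter P? H []       = refl
eval-filter P? H (x ∷ xs) with does (P? x)
... | true  = cong (1ℚ * H x +_) (eval-filter P? H xs)
... | false = trans (eval-filter P? H xs)
                    (sym (trans (cong (_+ _) (ℚ.*-zeroˡ (H x))) (ℚ.+-identityˡ _)))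

eval-mono : ∀ A (H : Word → ℚ) → eval H (mono (false ∷ A , refl)) ≡ H (false ∷ A) + H (flipWord (false ∷ A))
eval-mono A H = begin
  eval H (mono (false ∷ A , refl))
    ≡⟨ eval-filter _ H (allWords n) ⟩
  ∑[ u ← allWords n ] (𝟙 (does (samePattern u (false ∷ A) ≟ true)) * H u)
    ≡⟨ ∑-congAll (allWords n) (All.map (λ {u} |u| → trans (cong (_* H u) (𝟙-samePattern A u |u|))
                                                            (ℚ.*-distribʳ-+ (H u) (W.δ u (false ∷ A)) (W.δ u (flipWord (false ∷ A)))))
                                       (allWords-length n)) ⟩
  ∑[ u ← allWords n ] (W.δ u (false ∷ A) * H u + W.δ u (flipWord (false ∷ A)) * H u)
    ≡⟨ ∑-+ _ _ (allWords n) ⟩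
  ∑[ u ← allWords n ] (W.δ u (false ∷ A) * H u) + ∑[ u ← allWords n ] (W.δ u (flipWord (false ∷ A)) * H u)
    ≡⟨ cong₂ _+_ (∑-allWords-δ n (false ∷ A) H refl)
                 (∑-allWords-δ n (flipWord (false ∷ A)) H (length-map not (false ∷ A))) ⟩
  H (false ∷ A) + H (flipWord (false ∷ A)) ∎
  where
  n = suc (length A)

-- Runs

wordFrom : Bool → Comp → Word
wordFrom b []      = []
wordFrom b (k ∷ α) = replicate k b ++ wordFrom (not b) α

-- Only a composition with first part 0 yields a word starting with `true`.
canonical : Word → SetPart2
canonical []          = [] , tt
canonical (false ∷ w) = false ∷ w , refl
canonical (true ∷ w)  = flipWord (true ∷ w) , refl

fromRuns : Comp → SetPart2
fromRuns α = canonical (wordFrom false α)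

replicate-++-∷ : ∀ k (b : Bool) w → replicate k b ++ b ∷ w ≡ b ∷ replicate k b ++ w
replicate-++-∷ zero    b w = refl
replicate-++-∷ (suc k) b w = cong (b ∷_) (replicate-++-∷ k b w)

wordFrom-runsFrom : ∀ b k w → wordFrom b (runsFrom b k w) ≡ replicate k b ++ w
wordFrom-runsFrom b     k []          = refl
wordFrom-runsFrom false k (false ∷ w) = trans (wordFrom-runsFrom false (suc k) w) (sym (replicate-++-∷ k false w))
wordFrom-runsFrom false k (true ∷ w)  = cong (replicate k false ++_) (wordFrom-runsFrom true 1 w)
wordFrom-runsFrom true  k (true ∷ w)  = trans (wordFrom-runsFrom true (suc k) w) (sym (replicate-++-∷ k true w))
wordFrom-runsFrom true  k (false ∷ w) = cong (replicate k true ++_) (wordFrom-runsFrom false 1 w)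

fromRuns-cmp : ∀ A → mono (fromRuns (cmp A)) ≡ mono A
fromRuns-cmp ([] , _)           = refl
fromRuns-cmp (false ∷ A , refl) rewrite wordFrom-runsFrom false 1 A = refl

runsFrom-same : ∀ b k w → runsFrom b k (b ∷ w) ≡ runsFrom b (suc k) w
runsFrom-same false k w = refl
runsFrom-same true  k w = refl

runsFrom-not : ∀ b k w → runsFrom b k (not b ∷ w) ≡ k ∷ runsFrom (not b) 1 w
runsFrom-not false k w = refl
runsFrom-not true  k w = refl

runsFrom-wordFrom : ∀ b j k α → All (1 ≤_) α →
                    runsFrom b j (replicate k b ++ wordFrom (not b) α) ≡ j +ℕ k ∷ α
runsFrom-wordFrom b j (suc k) α valid = begin
  runsFrom b j (b ∷ w)        ≡⟨ runsFrom-same b j w ⟩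
  runsFrom b (suc j) w        ≡⟨ runsFrom-wordFrom b (suc j) k α valid ⟩
  suc j +ℕ k ∷ α              ≡⟨ cong (_∷ α) (sym (ℕ.+-suc j k)) ⟩
  j +ℕ suc k ∷ α              ∎
  where
  w = replicate k b ++ wordFrom (not b) α
runsFrom-wordFrom b j zero []              []              = cong (_∷ []) (sym (ℕ.+-identityʳ j))
runsFrom-wordFrom b j zero (suc k ∷ α) (_ ∷ valid) = begin
  runsFrom b j (not b ∷ w)      ≡⟨ runsFrom-not b j w ⟩
  j ∷ runsFrom (not b) 1 w      ≡⟨ cong₂ _∷_ (sym (ℕ.+-identityʳ j)) (runsFrom-wordFrom (not b) 1 k α valid) ⟩
  j +ℕ 0 ∷ suc k ∷ α            ∎
  where
  w = replicate k (not b) ++ wordFrom (not (not b)) α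

cmp-fromRuns : ∀ α → All (1 ≤_) α → cmp (fromRuns α) ≡ α
cmp-fromRuns []          []              = refl
cmp-fromRuns (suc k ∷ α) (_ ∷ valid) = runsFrom-wordFrom false 1 k α valid

runsFrom-flip : ∀ b k w → runsFrom (not b) k (flipWord w) ≡ runsFrom b k w
runsFrom-flip b     k []          = refl
runsFrom-flip false k (false ∷ w) = runsFrom-flip false (suc k) w
runsFrom-flip false k (true ∷ w)  = cong (k ∷_) (runsFrom-flip true 1 w)
runsFrom-flip true  k (true ∷ w)  = runsFrom-flip true (suc k) w
runsFrom-flip true  k (false ∷ w) = cong (k ∷_) (runsFrom-flip false 1 w)

runsFrom-addToFirst : ∀ b k j w → runsFrom b (k +ℕ j) w ≡ addToFirst k (runsFrom b j w)
runsFrom-addToFirst b     k j []          = refl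
runsFrom-addToFirst false k j (false ∷ w) = trans (cong (λ n → runsFrom false n w) (sym (ℕ.+-suc k j)))
                                                  (runsFrom-addToFirst false k (suc j) w)
runsFrom-addToFirst false k j (true ∷ w)  = refl
runsFrom-addToFirst true  k j (true ∷ w)  = trans (cong (λ n → runsFrom true n w) (sym (ℕ.+-suc k j)))
                                                  (runsFrom-addToFirst true k (suc j) w)
runsFrom-addToFirst true  k j (false ∷ w) = refl

runsFrom-nonempty : ∀ b k w → ∃₂ λ a r → runsFrom b k w ≡ a ∷ r
runsFrom-nonempty b     k []          = k , [] , refl
runsFrom-nonempty false k (false ∷ w) = runsFrom-nonempty false (suc k) w
runsFrom-nonempty false k (true ∷ w)  = k , _ , refl
runsFrom-nonempty true  k (true ∷ w)  = runsFrom-nonempty true (suc k) w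
runsFrom-nonempty true  k (false ∷ w) = k , _ , refl

concatRuns : Bool → Comp → Comp → Comp
concatRuns merge α β = if merge then α ⊙ β else α ++ β

concatRuns-∷ : ∀ merge k b j w β →
               concatRuns merge (k ∷ runsFrom b j w) β ≡ k ∷ concatRuns merge (runsFrom b j w) β
concatRuns-∷ merge k b j w β with runsFrom b j w | runsFrom-nonempty b j w
concatRuns-∷ true  k b j w β | _ | _ , _ , refl = refl
concatRuns-∷ false k b j w β | _ | _ , _ , refl = refl

lastLetter : Bool → Word → Bool
lastLetter b []      = b
lastLetter b (c ∷ w) = lastLetter c w

runsFrom-++ : ∀ b k w c v →
  runsFrom b k (w ++ c ∷ v) ≡ concatRuns (eqB (lastLetter b w) c) (runsFrom b k w) (runsFrom c 1 v)
runsFrom-++ false k []          false v = trans (cong (λ n → runsFrom false n v) (ℕ.+-comm 1 k))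
                                                (runsFrom-addToFirst false k 1 v)
runsFrom-++ false k []          true  v = refl
runsFrom-++ true  k []          true  v = trans (cong (λ n → runsFrom true n v) (ℕ.+-comm 1 k))
                                                (runsFrom-addToFirst true k 1 v)
runsFrom-++ true  k []          false v = refl
runsFrom-++ false k (false ∷ w) c v = runsFrom-++ false (suc k) w c v
runsFrom-++ false k (true ∷ w)  c v = trans (cong (k ∷_) (runsFrom-++ true 1 w c v))
                                            (sym (concatRuns-∷ (eqB (lastLetter true w) c) k true 1 w (runsFrom c 1 v)))
runsFrom-++ true  k (true ∷ w)  c v = runsFrom-++ true (suc k) w c v
runsFrom-++ true  k (false ∷ w) c v = trans (cong (k ∷_) (runsFrom-++ false 1 w c v))
                                            (sym (concatRuns-∷ (eqB (lastLetter false w) c) k false 1 w (runsFrom c 1 v)))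

cmp-products : ∀ A B → let α = runsFrom false 1 A; β = runsFrom false 1 B in
  (runsFrom false 1 (A ++ false ∷ B) ≡ α ++ β × runsFrom false 1 (A ++ true ∷ flipWord B) ≡ α ⊙ β)
  ⊎ (runsFrom false 1 (A ++ false ∷ B) ≡ α ⊙ β × runsFrom false 1 (A ++ true ∷ flipWord B) ≡ α ++ β)
cmp-products A B
  rewrite runsFrom-++ false 1 A false B | runsFrom-++ false 1 A true (flipWord B) | runsFrom-flip false 1 B
  with lastLetter false A
... | false = inj₂ (refl , refl)
... | true  = inj₁ (refl , refl)

-- The map ι

mulBasis : SetPart2 → SetPart2 → NCComb
mulBasis ([] , _)     B            = (1ℚ , B) ∷ []
mulBasis (b ∷ A , pA) ([] , _)     = (1ℚ , (b ∷ A , pA)) ∷ []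
mulBasis (b ∷ A , pA) (c ∷ B , _)  =
  (1ℚ , (b ∷ A ++ c ∷ B , pA)) ∷ (1ℚ , (b ∷ A ++ flipWord (c ∷ B) , pA)) ∷ []

infixl 7 _*NC_
_*NC_ : NCComb → NCComb → NCComb
f *NC g = bind (λ A → bind (mulBasis A) g) f

eval-mono-⊛ : ∀ A B (H : Word → ℚ) → eval H (mono A ⊛ mono B) ≡ eval H (emb (mulBasis A B))
eval-mono-⊛ ([] , _)           B              H = trans (eval-⊛-unitˡ H (mono B)) (sym (eval-bind-single H mono B))
eval-mono-⊛ (false ∷ A , refl) ([] , _)       H =
  trans (eval-⊛-unitʳ H (mono (false ∷ A , refl))) (sym (eval-bind-single H mono (false ∷ A , refl)))
eval-mono-⊛ (false ∷ A , refl) (false ∷ B , refl) H = begin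
  eval H (mono (A′ , refl) ⊛ mono (B′ , refl))
    ≡⟨ eval-⊛ H (mono (A′ , refl)) (mono (B′ , refl)) ⟩
  eval (λ u → eval (λ u' → H (u ++ u')) (mono (B′ , refl))) (mono (A′ , refl))
    ≡⟨ eval-cong (λ u → eval-mono B (λ u' → H (u ++ u'))) (mono (A′ , refl)) ⟩
  eval (λ u → H (u ++ B′) + H (u ++ flipWord B′)) (mono (A′ , refl))
    ≡⟨ eval-mono A _ ⟩
  (H (A′ ++ B′) + H (A′ ++ flipWord B′)) + (H (flipWord A′ ++ B′) + H (flipWord A′ ++ flipWord B′))
    ≡⟨ [p+q]+[r+s]≡[p+s]+[q+r] (H (A′ ++ B′)) (H (A′ ++ flipWord B′))
                               (H (flipWord A′ ++ B′)) (H (flipWord A′ ++ flipWord B′)) ⟩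
  (H (A′ ++ B′) + H (flipWord A′ ++ flipWord B′)) + (H (A′ ++ flipWord B′) + H (flipWord A′ ++ B′))
    ≡⟨ cong₂ (λ u v → (H (A′ ++ B′) + H u) + (H (A′ ++ flipWord B′) + H v))
             (sym (map-++ not A′ B′))
             (trans (cong (flipWord A′ ++_) (sym (flipWord-involutive B′))) (sym (map-++ not A′ (flipWord B′)))) ⟩
  (H (A′ ++ B′) + H (flipWord (A′ ++ B′))) + (H (A′ ++ flipWord B′) + H (flipWord (A′ ++ flipWord B′)))
    ≡⟨ sym (cong₂ _+_ (eval-mono (A ++ B′) H) (eval-mono (A ++ flipWord B′) H)) ⟩
  eval H (mono (A′ ++ B′ , refl)) + eval H (mono (A′ ++ flipWord B′ , refl))
    ≡⟨ sym (eval-bind-pair H mono (A′ ++ B′ , refl) (A′ ++ flipWord B′ , refl)) ⟩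
  eval H (emb (mulBasis (A′ , refl) (B′ , refl))) ∎
  where
  A′ = false ∷ A
  B′ = false ∷ B

eval-ribbon-runs-⊛ : ∀ A B (H : Comp → ℚ) → let α = runsFrom false 1 A; β = runsFrom false 1 B in
  eval H (ribbon α ⊛ ribbon β) ≡ eval H (ribbon (α ++ β)) + eval H (ribbon (α ⊙ β))
eval-ribbon-runs-⊛ A B H
  with runsFrom false 1 A | runsFrom-nonempty false 1 A | runsFrom false 1 B | runsFrom-nonempty false 1 B
... | _ | a , r , refl | _ | d , s , refl = eval-ribbon-⊛ a r d s H

eval-ribbon-cmp-⊛ : ∀ A B (H : Comp → ℚ) →
  eval H (ribbon (cmp A) ⊛ ribbon (cmp B)) ≡ eval H (bind (ribbon ∘ cmp) (mulBasis A B))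
eval-ribbon-cmp-⊛ ([] , _) B H =
  trans (eval-⊛-unitˡ H (ribbon (cmp B))) (sym (eval-bind-single H (ribbon ∘ cmp) B))
eval-ribbon-cmp-⊛ (false ∷ A , refl) ([] , _) H =
  trans (eval-⊛-unitʳ H (ribbon (cmp (false ∷ A , refl))))
        (sym (eval-bind-single H (ribbon ∘ cmp) (false ∷ A , refl)))
eval-ribbon-cmp-⊛ (false ∷ A , refl) (false ∷ B , refl) H = begin
  eval H (ribbon α ⊛ ribbon β)
    ≡⟨ eval-ribbon-runs-⊛ A B H ⟩
  eval H (ribbon (α ++ β)) + eval H (ribbon (α ⊙ β))
    ≡⟨ products (cmp-products A B) ⟩
  eval H (ribbon (runsFrom false 1 (A ++ false ∷ B))) + eval H (ribbon (runsFrom false 1 (A ++ true ∷ flipWord B)))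
    ≡⟨ sym (eval-bind-pair H (ribbon ∘ cmp) (false ∷ A ++ false ∷ B , refl)
                                            (false ∷ A ++ flipWord (false ∷ B) , refl)) ⟩
  eval H (bind (ribbon ∘ cmp) (mulBasis (false ∷ A , refl) (false ∷ B , refl))) ∎
  where
  α = runsFrom false 1 A
  β = runsFrom false 1 B
  products : ∀ {γ γ'} → (γ ≡ α ++ β × γ' ≡ α ⊙ β) ⊎ (γ ≡ α ⊙ β × γ' ≡ α ++ β) →
             eval H (ribbon (α ++ β)) + eval H (ribbon (α ⊙ β)) ≡ eval H (ribbon γ) + eval H (ribbon γ')
  products (inj₁ (refl , refl)) = refl
  products (inj₂ (refl , refl)) = ℚ.+-comm (eval H (ribbon (α ++ β))) (eval H (ribbon (α ⊙ β)))

-- Exactly one of the two words of m_A starts with `false`, so m_A is sent to R_{c(A)}.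
ιWord : Word → NSym
ιWord []          = ribbon []
ιWord (false ∷ w) = ribbon (runsFrom false 1 w)
ιWord (true ∷ w)  = []

eval-mono-ιWord : ∀ A (Φ : Comp → ℚ) → eval (λ u → eval Φ (ιWord u)) (mono A) ≡ eval Φ (ribbon (cmp A))
eval-mono-ιWord ([] , _)           Φ = eval-single (λ u → eval Φ (ιWord u)) []
eval-mono-ιWord (false ∷ A , refl) Φ = trans (eval-mono A (λ u → eval Φ (ιWord u))) (ℚ.+-identityʳ _)

eval-ι : ∀ (Φ : Comp → ℚ) f → eval Φ (ι f) ≡ eval (λ u → eval Φ (ιWord u)) (emb f)
eval-ι Φ f = begin
  eval Φ (ι f)                                              ≡⟨ eval-bind Φ (ribbon ∘ cmp) f ⟩
  eval (λ A → eval Φ (ribbon (cmp A))) f                    ≡⟨ eval-cong (λ A → sym (eval-mono-ιWord A Φ)) f ⟩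
  eval (λ A → eval (λ u → eval Φ (ιWord u)) (mono A)) f     ≡⟨ sym (eval-bind _ mono f) ⟩
  eval (λ u → eval Φ (ιWord u)) (emb f)                     ∎

-- The preimage of h_β = Σ_{δ coarsening β} R_δ.
ι⁻¹ : Comp → NCComb
ι⁻¹ β = map (λ δ → 1ℚ , fromRuns δ) (coarsenings β)

eval-ι⁻¹ : ∀ (K : SetPart2 → ℚ) β → eval K (ι⁻¹ β) ≡ ∑[ δ ← coarsenings β ] K (fromRuns δ)
eval-ι⁻¹ K β = trans (∑-map _ _ (coarsenings β)) (∑-cong (λ δ → ℚ.*-identityˡ _) (coarsenings β))

ι⁻¹-ribbon : ∀ γ (K : SetPart2 → ℚ) → eval (λ β → eval K (ι⁻¹ β)) (ribbon γ) ≡ K (fromRuns γ)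
ι⁻¹-ribbon γ K = trans (eval-cong (eval-ι⁻¹ K) (ribbon γ)) (eval-ribbon-∑coarsenings γ (K ∘ fromRuns))

ι-ι⁻¹ : ∀ β → All (1 ≤_) β → (Φ : Comp → ℚ) → eval (λ A → eval Φ (ribbon (cmp A))) (ι⁻¹ β) ≡ Φ β
ι-ι⁻¹ β valid Φ = begin
  eval (λ A → eval Φ (ribbon (cmp A))) (ι⁻¹ β)       ≡⟨ eval-ι⁻¹ _ β ⟩
  ∑[ δ ← coarsenings β ] eval Φ (ribbon (cmp (fromRuns δ)))
    ≡⟨ ∑-congAll (coarsenings β) (All.map (λ {δ} δ-valid → cong (eval Φ ∘ ribbon) (cmp-fromRuns δ δ-valid))
                                          (coarsenings-valid β valid)) ⟩
  ∑[ δ ← coarsenings β ] eval Φ (ribbon δ)            ≡⟨ ∑coarsenings-eval-ribbon β Φ ⟩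
  Φ β                                                 ∎

eval-emb : ∀ (Ψ : Word → ℚ) f → eval Ψ (emb f) ≡ eval (λ β → eval Ψ (emb (ι⁻¹ β))) (ι f)
eval-emb Ψ f = begin
  eval Ψ (emb f)                                                   ≡⟨ eval-bind Ψ mono f ⟩
  eval (λ A → eval Ψ (mono A)) f                                   ≡⟨ eval-cong basis f ⟩
  eval (λ A → eval (λ β → eval Ψ (emb (ι⁻¹ β))) (ribbon (cmp A))) f ≡⟨ sym (eval-bind _ (ribbon ∘ cmp) f) ⟩
  eval (λ β → eval Ψ (emb (ι⁻¹ β))) (ι f)                          ∎
  where
  basis : ∀ A → eval Ψ (mono A) ≡ eval (λ β → eval Ψ (emb (ι⁻¹ β))) (ribbon (cmp A))
  basis A = begin
    eval Ψ (mono A)                                              ≡⟨ cong (eval Ψ) (sym (fromRuns-cmp A)) ⟩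
    eval Ψ (mono (fromRuns (cmp A)))                             ≡⟨ sym (ι⁻¹-ribbon (cmp A) (eval Ψ ∘ mono)) ⟩
    eval (λ β → eval (eval Ψ ∘ mono) (ι⁻¹ β)) (ribbon (cmp A))   ≡⟨ eval-cong (λ β → sym (eval-bind Ψ mono (ι⁻¹ β))) (ribbon (cmp A)) ⟩
    eval (λ β → eval Ψ (emb (ι⁻¹ β))) (ribbon (cmp A))          ∎

ι-cong : ∀ f g → emb f ≈P emb g → ι f ≈N ι g
ι-cong f g f≈g = eval≡⇒≈N (ι f) (ι g) λ Φ → begin
  eval Φ (ι f)                            ≡⟨ eval-ι Φ f ⟩
  eval (λ u → eval Φ (ιWord u)) (emb f)   ≡⟨ ≈P⇒eval≡ (λ u → eval Φ (ιWord u)) (emb f) (emb g) f≈g ⟩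
  eval (λ u → eval Φ (ιWord u)) (emb g)   ≡⟨ sym (eval-ι Φ g) ⟩
  eval Φ (ι g)                            ∎

ι-injective : ∀ f g → ι f ≈N ι g → emb f ≈P emb g
ι-injective f g f≈g = eval≡⇒≈P (emb f) (emb g) λ Ψ → begin
  eval Ψ (emb f)                            ≡⟨ eval-emb Ψ f ⟩
  eval (λ β → eval Ψ (emb (ι⁻¹ β))) (ι f)   ≡⟨ ≈N⇒eval≡ (λ β → eval Ψ (emb (ι⁻¹ β))) (ι f) (ι g) f≈g ⟩
  eval (λ β → eval Ψ (emb (ι⁻¹ β))) (ι g)   ≡⟨ sym (eval-emb Ψ g) ⟩
  eval Ψ (emb g)                            ∎

ι-surjective : ∀ y → ValidNSym y → ι (bind ι⁻¹ y) ≈N y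
ι-surjective y valid = eval≡⇒≈N (ι (bind ι⁻¹ y)) y λ Φ → begin
  eval Φ (ι (bind ι⁻¹ y))                                       ≡⟨ eval-bind Φ (ribbon ∘ cmp) (bind ι⁻¹ y) ⟩
  eval (λ A → eval Φ (ribbon (cmp A))) (bind ι⁻¹ y)             ≡⟨ eval-bind _ ι⁻¹ y ⟩
  eval (λ β → eval (λ A → eval Φ (ribbon (cmp A))) (ι⁻¹ β)) y   ≡⟨ eval-congAll y (All.map (λ {t} v → ι-ι⁻¹ (proj₂ t) v Φ) valid) ⟩
  eval Φ y                                                      ∎

emb-*NC : ∀ f g → emb (f *NC g) ≈P emb f *P emb g
emb-*NC f g = eval≡⇒≈P (emb (f *NC g)) (emb f *P emb g) λ H → sym (eval-bind-⊛ mono mulBasis eval-mono-⊛ f g H)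

ι-*NC : ∀ f g → ι (f *NC g) ≈N ι f *N ι g
ι-*NC f g = eval≡⇒≈N (ι (f *NC g)) (ι f *N ι g) λ Φ →
  sym (eval-bind-⊛ (ribbon ∘ cmp) mulBasis eval-ribbon-cmp-⊛ f g Φ)

ι-* : ∀ f g h → emb h ≈P emb f *P emb g → ι h ≈N ι f *N ι g
ι-* f g h h≈fg α = trans (ι-cong h (f *NC g) (λ w → trans (h≈fg w) (sym (emb-*NC f g w))) α) (ι-*NC f g α)

mainTheorem5 :
    -- ι is well defined on NCSym₂ (depends only on the polynomial)
    (∀ f g → emb f ≈P emb g → ι f ≈N ι g)
    -- ι is injective
    × (∀ f g → ι f ≈N ι g → emb f ≈P emb g)
    -- ι is surjective onto NSym
    × (∀ y → ValidNSym y → ∃ λ f → ι f ≈N y)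
    -- NCSym₂ is closed under the product of ℚ⟨X₂⟩
    × (∀ f g → ∃ λ h → emb h ≈P emb f *P emb g)
    -- ι is multiplicative
    × (∀ f g h → emb h ≈P emb f *P emb g → ι h ≈N ι f *N ι g)
    -- ι preserves the unit
    × (ι oneNC ≈N oneN)
mainTheorem5 =
    ι-cong
  , ι-injective
  , (λ y valid → bind ι⁻¹ y , ι-surjective y valid)
  , (λ f g → f *NC g , emb-*NC f g)
  , ι-*
  , λ _ → refl
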